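{- $\Xi(5)=8$, $\Xi(6)=9$, and $11\le\Xi(7)\le 12$.
   Context: All graphs are finite, simple and undirected. For a graph $G=(V,E)$ and $x\in V$, $N[x]=\{x\}\cup\{y: xy\in E\}$. A set $C\subseteq V$ is identifying if $N[x]\cap C\ne\emptyset$ for every $x\in V$ and $N[x]\cap C\neq N[y]\cap C$ for all distinct $x,y\in V$. For $n\ge k\ge1$, $\mathfrak{Gr}(n,k)$ is the set of graphs on $n$ vertices in which every $k$-element subset of vertices is identifying, and $\Xi(k)=\max\{n\ge k:\mathfrak{Gr}(n,k)\ne\emptyset\}$. -}

module Defs where

open import Data.Nat using (ℕ; _≤_; _<_)
open import Data.Bool using (Bool; false; _∨_)
open import Data.Fin using (Fin; _≟_)
open import Data.Fin.Subset using (Subset; _∩_; Nonempty; ∣_∣)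
open import Data.Vec using (tabulate)
open import Data.Product using (Σ; _×_)
open import Relation.Nullary using (¬_)
open import Relation.Nullary.Decidable using (⌊_⌋)
open import Relation.Binary.PropositionalEquality using (_≡_; _≢_)

record Graph (n : ℕ) : Set where
  field
    adj    : Fin n → Fin n → Bool
    sym    : ∀ x y → adj x y ≡ adj y x
    irrefl : ∀ x → adj x x ≡ false
open Graph public

N[_]⟨_⟩ : ∀ {n} → Graph n → Fin n → Subset n
N[ G ]⟨ x ⟩ = tabulate (λ y → ⌊ x ≟ y ⌋ ∨ adj G x y)

Identifying : ∀ {n} → Graph n → Subset n → Set
Identifying {n} G C =
  (∀ (x : Fin n) → Nonempty (N[ G ]⟨ x ⟩ ∩ C)) ×
  (∀ (x y : Fin n) → x ≢ y → (N[ G ]⟨ x ⟩ ∩ C) ≢ (N[ G ]⟨ y ⟩ ∩ C))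

InGr : ∀ {n} → Graph n → ℕ → Set
InGr {n} G k = ∀ (C : Subset n) → ∣ C ∣ ≡ k → Identifying G C

GrNonempty : ℕ → ℕ → Set
GrNonempty n k = Σ (Graph n) (λ G → InGr G k)

-- Ξ(k) = m, i.e. m is the maximum of {n ≥ k : 𝔊𝔯(n,k) ≠ ∅}.
IsXi : ℕ → ℕ → Set
IsXi k m = (k ≤ m) × GrNonempty m k × (∀ n → m < n → ¬ GrNonempty n k)

module Submission where

-- Every k-subset of vertices is identifying exactly when every closed neighbourhood misses
-- fewer than k vertices and any two distinct closed neighbourhoods agree on fewer than k
-- vertices.  Deleting a vertex keeps both bounds, so Ξ(k) = m follows from one such graph on
-- m vertices, checked by evaluation, and none on m + 1.
--
-- For the non-existence, pass to the complement graph: with d the co-degree, a the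
-- agreement and m(x, y) the number of common co-neighbours, a(x, y) + d(x) + d(y) =
-- n + 2 m(x, y), and summing over all pairs gives Σ a + 2n Σ d = n³ + 2 Σ d².  For n = 2c + 1
-- and k = c + 1 this forces d ≡ c, so every a(x, y) is odd, hence at most c - 1 when c is
-- even, which is too small for Σ_y m(x, y) = c².  For n = 10 and k = 6 parity also gives
-- a(x, y) ≤ 4 when d(x) ≡ d(y) (mod 2); with the handshake lemma all bounds become tight:
-- six vertices of co-degree 5, four of co-degree 4, and m(x, y) = 1 + [d(x) or d(y) odd].
-- Then every even vertex b has exactly one even co-neighbour, so a third even vertex c is
-- not a co-neighbour of b, and the unique common co-neighbour of b and c can be neither even
-- nor odd.

open import Data.Bool using (Bool; true; false; not; _∧_; _∨_; _xor_)
open import Data.Bool.ListAction using (any)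
open import Data.Bool.Properties
  using (not-¬; not-involutive; not-distribˡ-xor; ∧-zeroʳ; ∧-identityʳ; ∧-idem; xor-same; xor-assoc)
  renaming (_≟_ to _≟ᵇ_)
open import Data.Empty using (⊥; ⊥-elim)
open import Data.Fin using (Fin; zero; suc; punchIn; punchOut; toℕ; _≟_)
open import Data.Fin.Properties using (all?; suc-injective; punchInᵢ≢i; punchIn-punchOut)
open import Data.Fin.Subset using (Subset; ∣_∣; _∈_; _∩_; Nonempty; inside; outside) renaming (⊥ to ∅)
open import Data.Fin.Subset.Properties using (∣⊥∣≡0; ∉⊥; nonempty?; x∈p∩q⁺; x∈p∩q⁻)
open import Data.List using (List; []; _∷_)
open import Data.Nat using (ℕ; zero; suc; _+_; _*_; _∸_; _≤_; _<_; z≤n; s≤s; z<s; _≤?_; _<?_; _≡ᵇ_)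
open import Data.Nat.Properties hiding (_≟_; suc-injective)
open import Algebra.Properties.Semiring.Sum +-*-semiring
  using (sum; sum-syntax; sum-remove; sum-cong-≗; ∑-distrib-+; ∑-comm; *-distribˡ-sum; *-distribʳ-sum)
open import Data.Nat.Tactic.RingSolver using (solve-∀)
open import Data.Product using (Σ; ∃; _×_; _,_; proj₁; proj₂)
open import Data.Sum using (inj₁; inj₂)
open import Data.Vec using (Vec; []; _∷_; here; there; lookup)
open import Data.Vec.Properties
  using (lookup∘tabulate; lookup-zipWith; tabulate∘lookup; tabulate-cong; []=⇒lookup; lookup⇒[]=)
open import Function using (_∘_)
open import Relation.Binary.PropositionalEquality
open import Relation.Nullary using (¬_; Dec; yes; no; ¬?; contradiction)
open import Relation.Nullary.Decidable
  using (⌊_⌋; True; toWitness; from-yes; from-no; isYes≗does; dec-true; dec-false; _×-dec_; _→-dec_)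

open import Defs hiding (sym)

⟦_⟧ : Bool → ℕ
⟦ true ⟧ = 1
⟦ false ⟧ = 0

count : ∀ {n} → (Fin n → Bool) → ℕ
count p = sum (λ i → ⟦ p i ⟧)

count-cong : ∀ {n} {p q : Fin n → Bool} → (∀ i → p i ≡ q i) → count p ≡ count q
count-cong p≗q = sum-cong-≗ (cong ⟦_⟧ ∘ p≗q)

sum-const : ∀ n c → ∑[ i < n ] c ≡ n * c
sum-const zero c = refl
sum-const (suc n) c = cong (c +_) (sum-const n c)

sum-+₃ : ∀ {n} (f g h : Fin n → ℕ) → ∑[ i < n ] (f i + g i + h i) ≡ sum f + sum g + sum h
sum-+₃ f g h = trans (∑-distrib-+ (λ i → f i + g i) h) (cong (_+ sum h) (∑-distrib-+ f g))

sum-mono-≤ : ∀ {n} {f g : Fin n → ℕ} → (∀ i → f i ≤ g i) → sum f ≤ sum g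
sum-mono-≤ {zero} f≤g = z≤n
sum-mono-≤ {suc n} f≤g = +-mono-≤ (f≤g zero) (sum-mono-≤ (f≤g ∘ suc))

sum-mono-≤-tight : ∀ {n} {f g : Fin n → ℕ} → (∀ i → f i ≤ g i) → sum g ≤ sum f →
                   ∀ i → f i ≡ g i
sum-mono-≤-tight {suc n} {f} {g} f≤g g≤f zero = ≤-antisym (f≤g zero)
  (+-cancelʳ-≤ _ _ _ (≤-trans g≤f (+-monoʳ-≤ (f zero) (sum-mono-≤ (f≤g ∘ suc)))))
sum-mono-≤-tight {suc n} {f} {g} f≤g g≤f (suc i) = sum-mono-≤-tight (f≤g ∘ suc)
  (+-cancelˡ-≤ (g zero) _ _ (≤-trans g≤f (+-monoˡ-≤ _ (f≤g zero)))) i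

≤-sum : ∀ {n} (f : Fin n → ℕ) i → f i ≤ sum f
≤-sum {suc n} f i = ≤-trans (m≤m+n (f i) _) (≤-reflexive (sym (sum-remove {i = i} f)))

sum-≤-except : ∀ {n} (f : Fin (suc n) → ℕ) x {b} → (∀ y → y ≢ x → f y ≤ b) →
               sum f ≤ f x + n * b
sum-≤-except {n} f x {b} f≤b = begin
  sum f                                 ≡⟨ sum-remove {i = x} f ⟩
  f x + ∑[ j < n ] f (punchIn x j)      ≤⟨ +-monoʳ-≤ (f x) (sum-mono-≤ (λ j → f≤b _ (punchInᵢ≢i x j))) ⟩
  f x + ∑[ j < n ] b                    ≡⟨ cong (f x +_) (sum-const n b) ⟩
  f x + n * b                           ∎
  where open ≤-Reasoning

sum-≤-except-tight : ∀ {n} (f : Fin (suc n) → ℕ) x {b} → (∀ y → y ≢ x → f y ≤ b) →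
                     f x + n * b ≤ sum f → ∀ y → y ≢ x → f y ≡ b
sum-≤-except-tight {n} f x {b} f≤b tight y y≢x =
  subst (λ z → f z ≡ b) (punchIn-punchOut (y≢x ∘ sym)) (rest≡b (punchOut (y≢x ∘ sym)))
  where
  rest≡b : ∀ j → f (punchIn x j) ≡ b
  rest≡b = sum-mono-≤-tight (λ j → f≤b _ (punchInᵢ≢i x j)) (begin
    ∑[ j < n ] b                     ≡⟨ sum-const n b ⟩
    n * b                            ≤⟨ +-cancelˡ-≤ (f x) _ _ (≤-trans tight (≤-reflexive (sum-remove {i = x} f))) ⟩
    ∑[ j < n ] f (punchIn x j)       ∎)
    where open ≤-Reasoning

0<count⇒∃ : ∀ {n} (p : Fin n → Bool) → 0 < count p → ∃ λ i → p i ≡ true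
0<count⇒∃ {suc n} p 0<c with p zero in eq
... | true = zero , eq
... | false = let (i , pi) = 0<count⇒∃ (p ∘ suc) 0<c in suc i , pi

2≤count : ∀ {n} (p : Fin n → Bool) {u v} → u ≢ v → p u ≡ true → p v ≡ true → 2 ≤ count p
2≤count {suc n} p {u} {v} u≢v pu pv = begin
  1 + 1                                          ≡⟨ cong₂ (λ a b → ⟦ a ⟧ + ⟦ b ⟧) pu pv′ ⟨
  ⟦ p u ⟧ + ⟦ p (punchIn u (punchOut u≢v)) ⟧     ≤⟨ +-monoʳ-≤ ⟦ p u ⟧ (≤-sum (λ j → ⟦ p (punchIn u j) ⟧) _) ⟩
  ⟦ p u ⟧ + count (p ∘ punchIn u)                ≡⟨ sum-remove {i = u} (λ i → ⟦ p i ⟧) ⟨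
  count p                                        ∎
  where
  open ≤-Reasoning
  pv′ : p (punchIn u (punchOut u≢v)) ≡ true
  pv′ = trans (cong p (punchIn-punchOut u≢v)) pv

count-unique : ∀ {n} (p : Fin n → Bool) → count p ≡ 1 →
               ∀ {u v} → p u ≡ true → p v ≡ true → u ≡ v
count-unique p c≡1 {u} {v} pu pv with u ≟ v
... | yes u≡v = u≡v
... | no u≢v = ⊥-elim (2≰1 (subst (2 ≤_) c≡1 (2≤count p u≢v pu pv)))
  where
  2≰1 : ¬ 2 ≤ 1
  2≰1 (s≤s ())

⌊≟⌋-refl : ∀ {n} (x : Fin n) → ⌊ x ≟ x ⌋ ≡ true
⌊≟⌋-refl x = trans (isYes≗does (x ≟ x)) (dec-true (x ≟ x) refl)

⌊≟⌋-≢ : ∀ {n} {x y : Fin n} → x ≢ y → ⌊ x ≟ y ⌋ ≡ false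
⌊≟⌋-≢ {x = x} {y} x≢y = trans (isYes≗does (x ≟ y)) (dec-false (x ≟ y) x≢y)

count-≟ : ∀ {n} (x : Fin n) → count (λ y → ⌊ y ≟ x ⌋) ≡ 1
count-≟ {suc n} x = begin
  count (λ y → ⌊ y ≟ x ⌋)                              ≡⟨ sum-remove {i = x} (λ y → ⟦ ⌊ y ≟ x ⌋ ⟧) ⟩
  ⟦ ⌊ x ≟ x ⌋ ⟧ + count (λ j → ⌊ punchIn x j ≟ x ⌋)     ≡⟨ cong₂ _+_ (cong ⟦_⟧ (⌊≟⌋-refl x)) others ⟩
  1 + n * 0                                             ≡⟨ cong suc (*-zeroʳ n) ⟩
  1                                                     ∎
  where
  open ≡-Reasoning
  others : count (λ j → ⌊ punchIn x j ≟ x ⌋) ≡ n * 0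
  others = trans (count-cong (λ j → ⌊≟⌋-≢ (punchInᵢ≢i x j))) (sum-const n 0)

count-split : ∀ {n} (p q : Fin n → Bool) → count p ≡ count (λ i → p i ∧ q i) + count (λ i → p i ∧ not (q i))
count-split p q = trans (sum-cong-≗ λ i → pointwise (p i) (q i))
                        (∑-distrib-+ (λ i → ⟦ p i ∧ q i ⟧) (λ i → ⟦ p i ∧ not (q i) ⟧))
  where
  pointwise : ∀ a b → ⟦ a ⟧ ≡ ⟦ a ∧ b ⟧ + ⟦ a ∧ not b ⟧
  pointwise false b = refl
  pointwise true false = refl
  pointwise true true = refl

count+count-not : ∀ {n} (p : Fin n → Bool) → count p + count (not ∘ p) ≡ n
count+count-not {n} p = begin
  count p + count (not ∘ p)   ≡⟨ count-split (λ _ → true) p ⟨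
  ∑[ i < n ] 1                ≡⟨ sum-const n 1 ⟩
  n * 1                       ≡⟨ *-identityʳ n ⟩
  n                           ∎
  where open ≡-Reasoning

agreeing-pairs : ∀ {n} (p : Fin n → Bool) →
  ∑[ x < n ] count (λ y → not (p x xor p y)) ≡ count p * count p + count (not ∘ p) * count (not ∘ p)
agreeing-pairs {n} p = begin
  ∑[ x < n ] count (λ y → not (p x xor p y))
    ≡⟨ sum-cong-≗ (λ x → row (p x)) ⟩
  ∑[ x < n ] (⟦ p x ⟧ * count p + ⟦ not (p x) ⟧ * count (not ∘ p))
    ≡⟨ ∑-distrib-+ (λ x → ⟦ p x ⟧ * count p) (λ x → ⟦ not (p x) ⟧ * count (not ∘ p)) ⟩
  (∑[ x < n ] (⟦ p x ⟧ * count p)) + (∑[ x < n ] (⟦ not (p x) ⟧ * count (not ∘ p)))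
    ≡⟨ cong₂ _+_ (sym (*-distribʳ-sum (count p) (λ x → ⟦ p x ⟧)))
                 (sym (*-distribʳ-sum (count (not ∘ p)) (λ x → ⟦ not (p x) ⟧))) ⟩
  count p * count p + count (not ∘ p) * count (not ∘ p)
    ∎
  where
  open ≡-Reasoning
  row : ∀ b → count (λ y → not (b xor p y)) ≡ ⟦ b ⟧ * count p + ⟦ not b ⟧ * count (not ∘ p)
  row true  = trans (count-cong (not-involutive ∘ p)) (sym (trans (+-identityʳ _) (+-identityʳ _)))
  row false = sym (+-identityʳ _)

∃-outside-pair : ∀ {n} (p : Fin n → Bool) u v → 2 < count p → ∃ λ c → p c ≡ true × c ≢ u × c ≢ v
∃-outside-pair {n} p u v 2<count =
  let (c , c-other) = 0<count⇒∃ others (+-cancelʳ-≤ 2 1 (count others) (≤-trans 2<count count≤))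
  in c , split c c-other
  where
  others : Fin n → Bool
  others y = p y ∧ not (⌊ y ≟ u ⌋ ∨ ⌊ y ≟ v ⌋)
  split : ∀ c → others c ≡ true → p c ≡ true × c ≢ u × c ≢ v
  split c eq with p c | c ≟ u | c ≟ v
  split c () | false | _ | _
  split c () | true | yes _ | _
  split c () | true | no _ | yes _
  ... | true | no c≢u | no c≢v = refl , c≢u , c≢v
  count≤ : count p ≤ count others + 2
  count≤ = begin
    count p
      ≤⟨ sum-mono-≤ (λ y → pointwise (p y) ⌊ y ≟ u ⌋ ⌊ y ≟ v ⌋) ⟩
    ∑[ y < n ] (⟦ others y ⟧ + ⟦ ⌊ y ≟ u ⌋ ⟧ + ⟦ ⌊ y ≟ v ⌋ ⟧)
      ≡⟨ sum-+₃ (λ y → ⟦ others y ⟧) (λ y → ⟦ ⌊ y ≟ u ⌋ ⟧) (λ y → ⟦ ⌊ y ≟ v ⌋ ⟧) ⟩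
    count others + count (λ y → ⌊ y ≟ u ⌋) + count (λ y → ⌊ y ≟ v ⌋)
      ≡⟨ cong₂ (λ a b → count others + a + b) (count-≟ u) (count-≟ v) ⟩
    count others + 1 + 1
      ≡⟨ +-assoc (count others) 1 1 ⟩
    count others + 2
      ∎
    where
    open ≤-Reasoning
    pointwise : ∀ a b c → ⟦ a ⟧ ≤ ⟦ a ∧ not (b ∨ c) ⟧ + ⟦ b ⟧ + ⟦ c ⟧
    pointwise false b c = z≤n
    pointwise true false false = s≤s z≤n
    pointwise true false true = s≤s z≤n
    pointwise true true c = s≤s z≤n

subset-of-size : ∀ {n} (p : Fin n → Bool) k → k ≤ count p →
                 ∃ λ (C : Subset n) → ∣ C ∣ ≡ k × (∀ {i} → i ∈ C → p i ≡ true)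
subset-of-size {n} p zero _ = ∅ , ∣⊥∣≡0 n , λ i∈∅ → ⊥-elim (∉⊥ i∈∅)
subset-of-size {suc n} p (suc k) k<c with p zero in eq
... | true  = let (C , ∣C∣ , C⊆p) = subset-of-size (p ∘ suc) k (≤-pred k<c)
              in inside ∷ C , cong suc ∣C∣ , λ { here → eq ; (there i∈C) → C⊆p i∈C }
... | false = let (C , ∣C∣ , C⊆p) = subset-of-size (p ∘ suc) (suc k) k<c
              in outside ∷ C , ∣C∣ , λ { (there i∈C) → C⊆p i∈C }

∣∣≤count : ∀ {n} (C : Subset n) (p : Fin n → Bool) → (∀ {i} → i ∈ C → p i ≡ true) → ∣ C ∣ ≤ count p
∣∣≤count [] p C⊆p = z≤n
∣∣≤count (inside ∷ C) p C⊆p rewrite C⊆p here = s≤s (∣∣≤count C (p ∘ suc) (C⊆p ∘ there))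
∣∣≤count (outside ∷ C) p C⊆p = ≤-trans (∣∣≤count C (p ∘ suc) (C⊆p ∘ there)) (m≤n+m _ ⟦ p zero ⟧)

odd? : ℕ → Bool
odd? zero = false
odd? (suc n) = not (odd? n)

odd?-+ : ∀ m n → odd? (m + n) ≡ odd? m xor odd? n
odd?-+ zero n = refl
odd?-+ (suc m) n = trans (cong not (odd?-+ m n)) (not-distribˡ-xor (odd? m) (odd? n))

odd?-2* : ∀ m → odd? (2 * m) ≡ false
odd?-2* m = trans (trans (cong odd? (cong (m +_) (+-identityʳ m))) (odd?-+ m m)) (xor-same (odd? m))

odd?-⟦⟧ : ∀ b → odd? ⟦ b ⟧ ≡ b
odd?-⟦⟧ false = refl
odd?-⟦⟧ true = refl

odd?-count : ∀ {n} (f : Fin n → ℕ) → odd? (count (odd? ∘ f)) ≡ odd? (sum f)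
odd?-count {zero} f = refl
odd?-count {suc n} f = begin
  odd? (⟦ odd? (f zero) ⟧ + count (odd? ∘ f ∘ suc))
    ≡⟨ odd?-+ ⟦ odd? (f zero) ⟧ _ ⟩
  odd? ⟦ odd? (f zero) ⟧ xor odd? (count (odd? ∘ f ∘ suc))
    ≡⟨ cong₂ _xor_ (odd?-⟦⟧ (odd? (f zero))) (odd?-count (f ∘ suc)) ⟩
  odd? (f zero) xor odd? (sum (f ∘ suc))
    ≡⟨ odd?-+ (f zero) _ ⟨
  odd? (f zero + sum (f ∘ suc))
    ∎
  where open ≡-Reasoning

handshake : ∀ {n} (f : Fin n → Fin n → ℕ) → (∀ x y → f x y ≡ f y x) → (∀ x → f x x ≡ 0) →
            odd? (∑[ x < n ] ∑[ y < n ] f x y) ≡ false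
handshake {zero} f f-sym f-diag = refl
handshake {suc n} f f-sym f-diag = begin
  odd? ((f zero zero + R) + ∑[ x < n ] (f (suc x) zero + inner x))
    ≡⟨ cong₂ (λ a b → odd? ((a + R) + b)) (f-diag zero)
             (trans (∑-distrib-+ (λ x → f (suc x) zero) inner)
                    (cong (_+ rest) (sum-cong-≗ λ x → f-sym (suc x) zero))) ⟩
  odd? (R + (R + rest))
    ≡⟨ trans (odd?-+ R (R + rest)) (cong (odd? R xor_) (odd?-+ R rest)) ⟩
  odd? R xor (odd? R xor odd? rest)
    ≡⟨ xor-assoc (odd? R) (odd? R) (odd? rest) ⟨
  (odd? R xor odd? R) xor odd? rest
    ≡⟨ cong (_xor odd? rest) (xor-same (odd? R)) ⟩
  odd? rest
    ≡⟨ handshake (λ x y → f (suc x) (suc y)) (λ x y → f-sym (suc x) (suc y)) (f-diag ∘ suc) ⟩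
  false
    ∎
  where
  open ≡-Reasoning
  R = ∑[ y < n ] f zero (suc y)
  inner : Fin n → ℕ
  inner x = ∑[ y < n ] f (suc x) (suc y)
  rest = ∑[ x < n ] inner x

not≡true : ∀ {a} → not a ≡ true → a ≡ false
not≡true {false} _ = refl

∧-≡-true⁻ : ∀ {a b} → a ∧ b ≡ true → a ≡ true × b ≡ true
∧-≡-true⁻ {true} {true} refl = refl , refl

xnor≡true⇒≡ : ∀ {a b} → not (a xor b) ≡ true → a ≡ b
xnor≡true⇒≡ {false} {false} _ = refl
xnor≡true⇒≡ {true}  {true}  _ = refl

⟦∧⟧ : ∀ a b → ⟦ a ∧ b ⟧ ≡ ⟦ a ⟧ * ⟦ b ⟧
⟦∧⟧ false b = refl
⟦∧⟧ true b = sym (+-identityʳ ⟦ b ⟧)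

-- Closed neighbourhoods and the complement graph

inN : ∀ {n} → Graph n → Fin n → Fin n → Bool
inN G x y = ⌊ x ≟ y ⌋ ∨ adj G x y

adjᶜ : ∀ {n} → Graph n → Fin n → Fin n → Bool
adjᶜ G x y = not (inN G x y)

agrees : ∀ {n} → Graph n → Fin n → Fin n → Fin n → Bool
agrees G x y z = not (inN G x z xor inN G y z)

degᶜ : ∀ {n} → Graph n → Fin n → ℕ
degᶜ G x = count (adjᶜ G x)

agreement : ∀ {n} → Graph n → Fin n → Fin n → ℕ
agreement G x y = count (agrees G x y)

commonᶜ : ∀ {n} → Graph n → Fin n → Fin n → ℕ
commonᶜ G x y = count (λ z → adjᶜ G x z ∧ adjᶜ G y z)

Bounded : ∀ {n} → Graph n → ℕ → Set
Bounded {n} G k = (∀ x → degᶜ G x < k) × (∀ (x y : Fin n) → x ≢ y → agreement G x y < k)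

⌊≟⌋-sym : ∀ {n} (x y : Fin n) → ⌊ x ≟ y ⌋ ≡ ⌊ y ≟ x ⌋
⌊≟⌋-sym x y with x ≟ y
... | yes refl = sym (⌊≟⌋-refl x)
... | no x≢y = sym (⌊≟⌋-≢ (x≢y ∘ sym))

adjᶜ-sym : ∀ {n} (G : Graph n) x y → adjᶜ G x y ≡ adjᶜ G y x
adjᶜ-sym G x y = cong not (cong₂ _∨_ (⌊≟⌋-sym x y) (Graph.sym G x y))

adjᶜ-irrefl : ∀ {n} (G : Graph n) x → adjᶜ G x x ≡ false
adjᶜ-irrefl G x = cong (λ b → not (b ∨ adj G x x)) (⌊≟⌋-refl x)

adjᶜ⇒≢ : ∀ {n} (G : Graph n) {x y} → adjᶜ G x y ≡ true → y ≢ x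
adjᶜ⇒≢ G {x} x~x refl with trans (sym x~x) (adjᶜ-irrefl G x)
... | ()

∈N⇒inN : ∀ {n} (G : Graph n) x {i} → i ∈ N[ G ]⟨ x ⟩ → inN G x i ≡ true
∈N⇒inN G x {i} i∈N = trans (sym (lookup∘tabulate (inN G x) i)) ([]=⇒lookup i∈N)

inN⇒∈N : ∀ {n} (G : Graph n) x {i} → inN G x i ≡ true → i ∈ N[ G ]⟨ x ⟩
inN⇒∈N G x {i} i∈N = lookup⇒[]= i _ (trans (lookup∘tabulate (inN G x) i) i∈N)

lookup-N∩ : ∀ {n} (G : Graph n) x (C : Subset n) i → lookup (N[ G ]⟨ x ⟩ ∩ C) i ≡ inN G x i ∧ lookup C i
lookup-N∩ G x C i = trans (lookup-zipWith _∧_ i N[ G ]⟨ x ⟩ C) (cong (_∧ lookup C i) (lookup∘tabulate (inN G x) i))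

lookup-ext : ∀ {A : Set} {n} {u v : Vec A n} → (∀ i → lookup u i ≡ lookup v i) → u ≡ v
lookup-ext {u = u} {v} u≗v = trans (sym (tabulate∘lookup u)) (trans (tabulate-cong u≗v) (tabulate∘lookup v))

¬Nonempty-N∩⇒adjᶜ : ∀ {n} (G : Graph n) x (C : Subset n) → ¬ Nonempty (N[ G ]⟨ x ⟩ ∩ C) →
                    ∀ {i} → i ∈ C → adjᶜ G x i ≡ true
¬Nonempty-N∩⇒adjᶜ G x C empty {i} i∈C with inN G x i in i∈N
... | false = refl
... | true  = ⊥-elim (empty (i , x∈p∩q⁺ (inN⇒∈N G x i∈N , i∈C)))

adjᶜ⇒¬Nonempty-N∩ : ∀ {n} (G : Graph n) x (C : Subset n) → (∀ {i} → i ∈ C → adjᶜ G x i ≡ true) →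
                    ¬ Nonempty (N[ G ]⟨ x ⟩ ∩ C)
adjᶜ⇒¬Nonempty-N∩ G x C C⊆adjᶜ (i , i∈N∩C) =
  let (i∈N , i∈C) = x∈p∩q⁻ _ C i∈N∩C
  in not-¬ refl (trans (∈N⇒inN G x i∈N) (sym (C⊆adjᶜ i∈C)))

≡N∩⇒agrees : ∀ {n} (G : Graph n) x y (C : Subset n) → N[ G ]⟨ x ⟩ ∩ C ≡ N[ G ]⟨ y ⟩ ∩ C →
             ∀ {i} → i ∈ C → agrees G x y i ≡ true
≡N∩⇒agrees G x y C same {i} i∈C = begin
  not (inN G x i xor inN G y i)   ≡⟨ cong (λ b → not (inN G x i xor b)) inN≡ ⟨
  not (inN G x i xor inN G x i)   ≡⟨ cong not (xor-same (inN G x i)) ⟩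
  true                            ∎
  where
  open ≡-Reasoning
  on-C : ∀ {b c} → b ∧ lookup C i ≡ c ∧ lookup C i → b ≡ c
  on-C {b} {c} e = trans (sym (∧-identityʳ b))
    (trans (subst (λ t → b ∧ t ≡ c ∧ t) ([]=⇒lookup i∈C) e) (∧-identityʳ c))
  inN≡ : inN G x i ≡ inN G y i
  inN≡ = on-C (trans (sym (lookup-N∩ G x C i)) (trans (cong (λ s → lookup s i) same) (lookup-N∩ G y C i)))

agrees⇒≡N∩ : ∀ {n} (G : Graph n) x y (C : Subset n) → (∀ {i} → i ∈ C → agrees G x y i ≡ true) →
             N[ G ]⟨ x ⟩ ∩ C ≡ N[ G ]⟨ y ⟩ ∩ C
agrees⇒≡N∩ G x y C C⊆agrees = lookup-ext λ i →
  trans (lookup-N∩ G x C i) (trans (on-C i (lookup C i) refl) (sym (lookup-N∩ G y C i)))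
  where
  on-C : ∀ i b → lookup C i ≡ b → inN G x i ∧ b ≡ inN G y i ∧ b
  on-C i false _ = trans (∧-zeroʳ _) (sym (∧-zeroʳ _))
  on-C i true i∈C = cong (_∧ true) (xnor≡true⇒≡ (C⊆agrees (lookup⇒[]= i C i∈C)))

InGr⇒Bounded : ∀ {n} (G : Graph n) k → InGr G k → Bounded G k
InGr⇒Bounded G k ig = degᶜ<k , agreement<k
  where
  degᶜ<k : ∀ x → degᶜ G x < k
  degᶜ<k x with degᶜ G x <? k
  ... | yes lt = lt
  ... | no ≮ = let (C , ∣C∣≡k , C⊆adjᶜ) = subset-of-size (adjᶜ G x) k (≮⇒≥ ≮)
               in ⊥-elim (adjᶜ⇒¬Nonempty-N∩ G x C C⊆adjᶜ (proj₁ (ig C ∣C∣≡k) x))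
  agreement<k : ∀ x y → x ≢ y → agreement G x y < k
  agreement<k x y x≢y with agreement G x y <? k
  ... | yes lt = lt
  ... | no ≮ = let (C , ∣C∣≡k , C⊆agrees) = subset-of-size (agrees G x y) k (≮⇒≥ ≮)
               in ⊥-elim (proj₂ (ig C ∣C∣≡k) x y x≢y (agrees⇒≡N∩ G x y C C⊆agrees))

Bounded⇒InGr : ∀ {n} (G : Graph n) k → Bounded G k → InGr G k
Bounded⇒InGr G k (degᶜ<k , agreement<k) C ∣C∣≡k = nonempty , separated
  where
  k≤ : ∀ {p} → (∀ {i} → i ∈ C → p i ≡ true) → k ≤ count p
  k≤ {p} C⊆p = subst (_≤ count p) ∣C∣≡k (∣∣≤count C p C⊆p)
  nonempty : ∀ x → Nonempty (N[ G ]⟨ x ⟩ ∩ C)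
  nonempty x with nonempty? (N[ G ]⟨ x ⟩ ∩ C)
  ... | yes ne = ne
  ... | no ¬ne = ⊥-elim (<⇒≱ (degᶜ<k x) (k≤ (¬Nonempty-N∩⇒adjᶜ G x C ¬ne)))
  separated : ∀ x y → x ≢ y → N[ G ]⟨ x ⟩ ∩ C ≢ N[ G ]⟨ y ⟩ ∩ C
  separated x y x≢y same = <⇒≱ (agreement<k x y x≢y) (k≤ (≡N∩⇒agrees G x y C same))

deleteZero : ∀ {n} → Graph (suc n) → Graph n
deleteZero G = record
  { adj    = λ x y → adj G (suc x) (suc y)
  ; sym    = λ x y → Graph.sym G (suc x) (suc y)
  ; irrefl = irrefl G ∘ suc
  }

inN-deleteZero : ∀ {n} (G : Graph (suc n)) x y → inN (deleteZero G) x y ≡ inN G (suc x) (suc y)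
inN-deleteZero G x y = cong (_∨ adj G (suc x) (suc y)) (⌊suc≟suc⌋ x y)
  where
  ⌊suc≟suc⌋ : ∀ {n} (x y : Fin n) → ⌊ x ≟ y ⌋ ≡ ⌊ suc x ≟ suc y ⌋
  ⌊suc≟suc⌋ x y with x ≟ y
  ... | yes _ = refl
  ... | no _  = refl

Bounded-deleteZero : ∀ {n} (G : Graph (suc n)) {k} → Bounded G k → Bounded (deleteZero G) k
Bounded-deleteZero G (degᶜ<k , agreement<k) =
  (λ x → ≤-<-trans (≤-trans (≤-reflexive (count-cong λ y → cong not (inN-deleteZero G x y))) (m≤n+m _ _))
                   (degᶜ<k (suc x))) ,
  (λ x y x≢y → ≤-<-trans (≤-trans (≤-reflexive (count-cong λ z → cong₂ (λ a b → not (a xor b))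
                                                   (inN-deleteZero G x z) (inN-deleteZero G y z)))
                                  (m≤n+m _ _))
                         (agreement<k (suc x) (suc y) (x≢y ∘ suc-injective)))

no-Bounded-above : ∀ {m k} → ¬ Σ (Graph (suc m)) (λ G → Bounded G k) →
                   ∀ {n} → m < n → ¬ Σ (Graph n) (λ G → Bounded G k)
no-Bounded-above none {suc n} (s≤s m≤n) (G , bounded) with m≤n⇒m<n∨m≡n m≤n
... | inj₂ refl = none (G , bounded)
... | inj₁ m<n  = no-Bounded-above none m<n (deleteZero G , Bounded-deleteZero G bounded)

IsXi-intro : ∀ k m → k ≤ m → Σ (Graph m) (λ G → Bounded G k) → ¬ Σ (Graph (suc m)) (λ G → Bounded G k) →
             IsXi k m
IsXi-intro k m k≤m (G , bounded) none =
  k≤m , (G , Bounded⇒InGr G k bounded) ,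
  λ n m<n (H , inGr) → no-Bounded-above none m<n (H , InGr⇒Bounded H k inGr)

agreement-diag : ∀ {n} (G : Graph n) x → agreement G x x ≡ n
agreement-diag {n} G x = begin
  count (λ z → not (inN G x z xor inN G x z))   ≡⟨ count-cong (λ z → cong not (xor-same (inN G x z))) ⟩
  ∑[ z < n ] 1                                  ≡⟨ sum-const n 1 ⟩
  n * 1                                         ≡⟨ *-identityʳ n ⟩
  n                                             ∎
  where open ≡-Reasoning

commonᶜ-diag : ∀ {n} (G : Graph n) x → commonᶜ G x x ≡ degᶜ G x
commonᶜ-diag G x = count-cong (λ z → ∧-idem (adjᶜ G x z))

agreement+degᶜ : ∀ {n} (G : Graph n) x y →
                 agreement G x y + degᶜ G x + degᶜ G y ≡ n + 2 * commonᶜ G x y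
agreement+degᶜ {n} G x y = begin
  agreement G x y + degᶜ G x + degᶜ G y
    ≡⟨ sum-+₃ (λ z → ⟦ agrees G x y z ⟧) (λ z → ⟦ adjᶜ G x z ⟧) (λ z → ⟦ adjᶜ G y z ⟧) ⟨
  ∑[ z < n ] (⟦ agrees G x y z ⟧ + ⟦ adjᶜ G x z ⟧ + ⟦ adjᶜ G y z ⟧)
    ≡⟨ sum-cong-≗ (λ z → pointwise (inN G x z) (inN G y z)) ⟩
  ∑[ z < n ] (1 + 2 * common z)
    ≡⟨ ∑-distrib-+ (λ _ → 1) (λ z → 2 * common z) ⟩
  (∑[ z < n ] 1) + ∑[ z < n ] (2 * common z)
    ≡⟨ cong₂ _+_ (trans (sum-const n 1) (*-identityʳ n)) (sym (*-distribˡ-sum 2 common)) ⟩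
  n + 2 * commonᶜ G x y
    ∎
  where
  open ≡-Reasoning
  common : Fin n → ℕ
  common z = ⟦ adjᶜ G x z ∧ adjᶜ G y z ⟧
  pointwise : ∀ a b → ⟦ not (a xor b) ⟧ + ⟦ not a ⟧ + ⟦ not b ⟧ ≡ 1 + 2 * ⟦ not a ∧ not b ⟧
  pointwise false false = refl
  pointwise false true  = refl
  pointwise true  false = refl
  pointwise true  true  = refl

commonᶜ-row : ∀ {n} (G : Graph n) x → ∑[ y < n ] commonᶜ G x y ≡ ∑[ w < n ] (⟦ adjᶜ G x w ⟧ * degᶜ G w)
commonᶜ-row {n} G x = begin
  ∑[ y < n ] ∑[ w < n ] ⟦ adjᶜ G x w ∧ adjᶜ G y w ⟧
    ≡⟨ ∑-comm (λ y w → ⟦ adjᶜ G x w ∧ adjᶜ G y w ⟧) ⟩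
  ∑[ w < n ] ∑[ y < n ] ⟦ adjᶜ G x w ∧ adjᶜ G y w ⟧
    ≡⟨ sum-cong-≗ (λ w → sum-cong-≗ λ y → trans (⟦∧⟧ (adjᶜ G x w) (adjᶜ G y w))
                                                (cong (λ b → ⟦ adjᶜ G x w ⟧ * ⟦ b ⟧) (adjᶜ-sym G y w))) ⟩
  ∑[ w < n ] ∑[ y < n ] (⟦ adjᶜ G x w ⟧ * ⟦ adjᶜ G w y ⟧)
    ≡⟨ sum-cong-≗ (λ w → sym (*-distribˡ-sum ⟦ adjᶜ G x w ⟧ (λ y → ⟦ adjᶜ G w y ⟧))) ⟩
  ∑[ w < n ] (⟦ adjᶜ G x w ⟧ * degᶜ G w)
    ∎
  where open ≡-Reasoning

commonᶜ-total : ∀ {n} (G : Graph n) →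
                ∑[ x < n ] ∑[ y < n ] commonᶜ G x y ≡ ∑[ w < n ] (degᶜ G w * degᶜ G w)
commonᶜ-total {n} G = begin
  ∑[ x < n ] ∑[ y < n ] commonᶜ G x y
    ≡⟨ sum-cong-≗ (commonᶜ-row G) ⟩
  ∑[ x < n ] ∑[ w < n ] (⟦ adjᶜ G x w ⟧ * degᶜ G w)
    ≡⟨ ∑-comm (λ x w → ⟦ adjᶜ G x w ⟧ * degᶜ G w) ⟩
  ∑[ w < n ] ∑[ x < n ] (⟦ adjᶜ G x w ⟧ * degᶜ G w)
    ≡⟨ sum-cong-≗ (λ w → sym (*-distribʳ-sum (degᶜ G w) (λ x → ⟦ adjᶜ G x w ⟧))) ⟩
  ∑[ w < n ] (count (λ x → adjᶜ G x w) * degᶜ G w)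
    ≡⟨ sum-cong-≗ (λ w → cong (_* degᶜ G w) (count-cong λ x → adjᶜ-sym G x w)) ⟩
  ∑[ w < n ] (degᶜ G w * degᶜ G w)
    ∎
  where open ≡-Reasoning

agreement-total : ∀ {n} (G : Graph n) →
  (∑[ x < n ] ∑[ y < n ] agreement G x y) + n * (∑[ x < n ] degᶜ G x) + n * (∑[ x < n ] degᶜ G x)
    ≡ n * (n * n) + 2 * (∑[ w < n ] (degᶜ G w * degᶜ G w))
agreement-total {n} G = begin
  A + n * D + n * D
    ≡⟨ cong₂ (λ a b → A + a + b)
             (trans (*-distribˡ-sum n (degᶜ G)) (sum-cong-≗ λ x → sym (sum-const n (degᶜ G x))))
             (sym (sum-const n D)) ⟩
  A + (∑[ x < n ] ∑[ y < n ] degᶜ G x) + (∑[ x < n ] D)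
    ≡⟨ sum-+₃ (λ x → ∑[ y < n ] agreement G x y) (λ x → ∑[ y < n ] degᶜ G x) (λ _ → D) ⟨
  ∑[ x < n ] ((∑[ y < n ] agreement G x y) + (∑[ y < n ] degᶜ G x) + D)
    ≡⟨ sum-cong-≗ (λ x → sym (sum-+₃ (agreement G x) (λ _ → degᶜ G x) (degᶜ G))) ⟩
  ∑[ x < n ] ∑[ y < n ] (agreement G x y + degᶜ G x + degᶜ G y)
    ≡⟨ sum-cong-≗ (λ x → sum-cong-≗ (agreement+degᶜ G x)) ⟩
  ∑[ x < n ] ∑[ y < n ] (n + 2 * commonᶜ G x y)
    ≡⟨ sum-cong-≗ (λ x → trans (∑-distrib-+ (λ _ → n) (λ y → 2 * commonᶜ G x y))
                               (cong₂ _+_ (sum-const n n) (sym (*-distribˡ-sum 2 (commonᶜ G x))))) ⟩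
  ∑[ x < n ] (n * n + 2 * (∑[ y < n ] commonᶜ G x y))
    ≡⟨ ∑-distrib-+ (λ _ → n * n) (λ x → 2 * (∑[ y < n ] commonᶜ G x y)) ⟩
  (∑[ x < n ] (n * n)) + (∑[ x < n ] (2 * (∑[ y < n ] commonᶜ G x y)))
    ≡⟨ cong₂ _+_ (sum-const n (n * n)) (sym (*-distribˡ-sum 2 (λ x → ∑[ y < n ] commonᶜ G x y))) ⟩
  n * (n * n) + 2 * (∑[ x < n ] ∑[ y < n ] commonᶜ G x y)
    ≡⟨ cong (λ s → n * (n * n) + 2 * s) (commonᶜ-total G) ⟩
  n * (n * n) + 2 * (∑[ w < n ] (degᶜ G w * degᶜ G w))
    ∎
  where
  open ≡-Reasoning
  A = ∑[ x < n ] ∑[ y < n ] agreement G x y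
  D = ∑[ x < n ] degᶜ G x

-- b, c, the common co-neighbours of a and b, and those of a and c are disjoint sets of
-- co-neighbours of a.
commonᶜ-packing : ∀ {n} (G : Graph n) {a b c} → adjᶜ G a b ≡ true → adjᶜ G a c ≡ true → b ≢ c →
                  adjᶜ G b c ≡ false → (∀ {w} → adjᶜ G b w ≡ true → adjᶜ G c w ≡ true → w ≡ a) →
                  2 + commonᶜ G a b + commonᶜ G a c ≤ degᶜ G a
commonᶜ-packing {n} G {a} {b} {c} a~b a~c b≢c b≁c common⊆a = begin
  2 + commonᶜ G a b + commonᶜ G a c
    ≤⟨ +-monoˡ-≤ _ (+-monoˡ-≤ _ (2≤count apart b≢c
         (only-first a~b (adjᶜ-irrefl G b) (trans (adjᶜ-sym G c b) b≁c))
         (only-first a~c b≁c (adjᶜ-irrefl G c)))) ⟩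
  count apart + commonᶜ G a b + commonᶜ G a c
    ≡⟨ sum-+₃ (λ w → ⟦ apart w ⟧) (λ w → ⟦ adjᶜ G a w ∧ adjᶜ G b w ⟧)
              (λ w → ⟦ adjᶜ G a w ∧ adjᶜ G c w ⟧) ⟨
  ∑[ w < n ] (⟦ apart w ⟧ + ⟦ adjᶜ G a w ∧ adjᶜ G b w ⟧ + ⟦ adjᶜ G a w ∧ adjᶜ G c w ⟧)
    ≤⟨ sum-mono-≤ (λ w → pointwise (adjᶜ G a w) (adjᶜ G b w) (adjᶜ G c w) a≁w) ⟩
  degᶜ G a
    ∎
  where
  open ≤-Reasoning
  apart : Fin n → Bool
  apart w = adjᶜ G a w ∧ (not (adjᶜ G b w) ∧ not (adjᶜ G c w))
  only-first : ∀ {x y z} → x ≡ true → y ≡ false → z ≡ false → x ∧ (not y ∧ not z) ≡ true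
  only-first refl refl refl = refl
  a≁w : ∀ {w} → adjᶜ G b w ≡ true → adjᶜ G c w ≡ true → adjᶜ G a w ≡ false
  a≁w b~w c~w = trans (cong (adjᶜ G a) (common⊆a b~w c~w)) (adjᶜ-irrefl G a)
  pointwise : ∀ x y z → (y ≡ true → z ≡ true → x ≡ false) →
              ⟦ x ∧ (not y ∧ not z) ⟧ + ⟦ x ∧ y ⟧ + ⟦ x ∧ z ⟧ ≤ ⟦ x ⟧
  pointwise false y z _ = z≤n
  pointwise true false false _ = s≤s z≤n
  pointwise true false true _ = s≤s z≤n
  pointwise true true false _ = s≤s z≤n
  pointwise true true true never with never refl refl
  ... | ()

-- Order 2c + 1 with k = c + 1 and c = 2h + 2

-- With c = d + e this is d (2c + 1 - d) = c (c + 1) - e (e + 1), free of subtraction.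
odd-order-gap : ∀ d e → 2 * (d * d) + ((d + e) + (d + e)) * suc (d + e)
                        ≡ suc ((d + e) + (d + e)) * d + suc ((d + e) + (d + e)) * d + 2 * (e * suc e)
odd-order-gap = solve-∀

odd-order-bound : ∀ c {d} → d ≤ c → suc (c + c) * d + suc (c + c) * d ≤ 2 * (d * d) + (c + c) * suc c
odd-order-bound c {d} d≤c with m≤n⇒∃[o]m+o≡n d≤c
... | e , refl = ≤-trans (m≤m+n _ _) (≤-reflexive (sym (odd-order-gap d e)))

odd-order-tight : ∀ c {d} → d ≤ c → suc (c + c) * d + suc (c + c) * d ≡ 2 * (d * d) + (c + c) * suc c →
                  d ≡ c
odd-order-tight c {d} d≤c eq with m≤n⇒∃[o]m+o≡n d≤c
... | zero  , refl = sym (+-identityʳ d)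
... | suc e , refl =
  ⊥-elim (0≢1+n (+-cancelˡ-≡ _ 0 _ (trans (+-identityʳ _) (trans eq (odd-order-gap d (suc e))))))

cube-split : ∀ c → suc (c + c) * (suc (c + c) * suc (c + c))
                   ≡ suc (c + c) * (suc (c + c) + (c + c) * c) + suc (c + c) * ((c + c) * suc c)
cube-split = solve-∀

square-split : ∀ h → (2 * suc h) * (2 * suc h) ≡ 2 * suc h + (2 * suc h + 2 * suc h) * h + 2 * suc h
square-split = solve-∀

module OddOrder (h : ℕ) (G : Graph (suc (2 * suc h + 2 * suc h))) (bounded : Bounded G (suc (2 * suc h))) where

  c n : ℕ
  c = 2 * suc h
  n = suc (c + c)

  d : Fin n → ℕ
  d = degᶜ G

  d≤c : ∀ x → d x ≤ c
  d≤c x = ≤-pred (proj₁ bounded x)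

  agreement≤c : ∀ x y → y ≢ x → agreement G x y ≤ c
  agreement≤c x y y≢x = ≤-pred (proj₂ bounded x y (y≢x ∘ sym))

  agreement-sum≤ : ∑[ x < n ] ∑[ y < n ] agreement G x y ≤ n * (n + (c + c) * c)
  agreement-sum≤ = begin
    ∑[ x < n ] ∑[ y < n ] agreement G x y       ≤⟨ sum-mono-≤ (λ x → sum-≤-except (agreement G x) x (agreement≤c x)) ⟩
    ∑[ x < n ] (agreement G x x + (c + c) * c)  ≡⟨ sum-cong-≗ (λ x → cong (_+ (c + c) * c) (agreement-diag G x)) ⟩
    ∑[ x < n ] (n + (c + c) * c)                ≡⟨ sum-const n (n + (c + c) * c) ⟩
    n * (n + (c + c) * c)                       ∎
    where open ≤-Reasoning

  bounds-attained : ∑[ x < n ] (2 * (d x * d x) + (c + c) * suc c) ≤ ∑[ x < n ] (n * d x + n * d x)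
  bounds-attained = +-cancelˡ-≤ B (∑[ x < n ] (2 * (d x * d x) + K)) (∑[ x < n ] (n * d x + n * d x)) (begin
    B + ∑[ x < n ] (2 * (d x * d x) + K)
      ≡⟨ cong (B +_) (trans (∑-distrib-+ (λ x → 2 * (d x * d x)) (λ _ → K))
                            (cong₂ _+_ (sym (*-distribˡ-sum 2 (λ x → d x * d x))) (sum-const n K))) ⟩
    B + (2 * Q + n * K)
      ≡⟨ trans (rearrange B (n * K) (2 * Q)) (cong (_+ 2 * Q) (sym (cube-split c))) ⟩
    n * (n * n) + 2 * Q
      ≡⟨ agreement-total G ⟨
    (∑[ x < n ] ∑[ y < n ] agreement G x y) + n * D + n * D
      ≤⟨ +-monoˡ-≤ (n * D) (+-monoˡ-≤ (n * D) agreement-sum≤) ⟩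
    B + n * D + n * D
      ≡⟨ +-assoc B (n * D) (n * D) ⟩
    B + (n * D + n * D)
      ≡⟨ cong (B +_) (trans (cong₂ _+_ (*-distribˡ-sum n d) (*-distribˡ-sum n d))
                            (sym (∑-distrib-+ (λ x → n * d x) (λ x → n * d x)))) ⟩
    B + ∑[ x < n ] (n * d x + n * d x)
      ∎)
    where
    open ≤-Reasoning
    B = n * (n + (c + c) * c)
    K = (c + c) * suc c
    D = ∑[ x < n ] d x
    Q = ∑[ x < n ] (d x * d x)
    rearrange : ∀ a b q → a + (q + b) ≡ a + b + q
    rearrange = solve-∀

  regular : ∀ x → d x ≡ c
  regular x = odd-order-tight c (d≤c x) (sum-mono-≤-tight (λ x → odd-order-bound c (d≤c x)) bounds-attained x)

  agreement-odd : ∀ x y → agreement G x y ≡ suc (2 * commonᶜ G x y)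
  agreement-odd x y = +-cancelʳ-≡ (c + c) _ _ (begin
    agreement G x y + (c + c)                 ≡⟨ +-assoc (agreement G x y) c c ⟨
    agreement G x y + c + c                   ≡⟨ cong₂ (λ a b → agreement G x y + a + b) (regular x) (regular y) ⟨
    agreement G x y + d x + d y               ≡⟨ agreement+degᶜ G x y ⟩
    n + 2 * commonᶜ G x y                     ≡⟨ cong suc (+-comm (c + c) _) ⟩
    suc (2 * commonᶜ G x y) + (c + c)         ∎)
    where open ≡-Reasoning

  commonᶜ≤h : ∀ x y → y ≢ x → commonᶜ G x y ≤ h
  commonᶜ≤h x y y≢x = ≤-pred (*-cancelˡ-< 2 _ _ (begin-strict
    2 * commonᶜ G x y         <⟨ n<1+n _ ⟩
    suc (2 * commonᶜ G x y)   ≡⟨ agreement-odd x y ⟨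
    agreement G x y           ≤⟨ agreement≤c x y y≢x ⟩
    2 * suc h                 ∎))
    where open ≤-Reasoning

  c*c≤ : c * c ≤ c + (c + c) * h
  c*c≤ = begin
    c * c                                    ≡⟨ cong (_* c) (regular zero) ⟨
    d zero * c                               ≡⟨ *-distribʳ-sum c (λ w → ⟦ adjᶜ G zero w ⟧) ⟩
    ∑[ w < n ] (⟦ adjᶜ G zero w ⟧ * c)       ≡⟨ sum-cong-≗ (λ w → cong (⟦ adjᶜ G zero w ⟧ *_) (regular w)) ⟨
    ∑[ w < n ] (⟦ adjᶜ G zero w ⟧ * d w)     ≡⟨ commonᶜ-row G zero ⟨
    ∑[ y < n ] commonᶜ G zero y              ≤⟨ sum-≤-except (commonᶜ G zero) zero (commonᶜ≤h zero) ⟩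
    commonᶜ G zero zero + (c + c) * h        ≡⟨ cong (_+ (c + c) * h) (trans (commonᶜ-diag G zero) (regular zero)) ⟩
    c + (c + c) * h                          ∎
    where open ≤-Reasoning

  absurd : ⊥
  absurd = <⇒≱ (m<m+n (c + (c + c) * h) {c} z<s) (subst (_≤ c + (c + c) * h) (square-split h) c*c≤)

no-Bounded-odd : ∀ h → let c = 2 * suc h in ¬ Σ (Graph (suc (c + c))) (λ G → Bounded G (suc c))
no-Bounded-odd h (G , bounded) = OddOrder.absurd h G bounded

-- Ten vertices and k = 6

module TenVertices (G : Graph 10) (bounded : Bounded G 6) where

  d : Fin 10 → ℕ
  d = degᶜ G

  odd : Fin 10 → Bool
  odd x = odd? (d x)

  same : Fin 10 → Fin 10 → Bool
  same x y = not (odd x xor odd y)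

  d≤5 : ∀ x → d x ≤ 5
  d≤5 x = ≤-pred (proj₁ bounded x)

  same-parity : ∀ x y → same x y ≡ not (odd? (agreement G x y))
  same-parity x y = sym (cong not (xor-solve (odd? (agreement G x y)) (odd x) (odd y) (begin
    (odd? (agreement G x y) xor odd x) xor odd y   ≡⟨ cong (_xor odd y) (odd?-+ (agreement G x y) (d x)) ⟨
    odd? (agreement G x y + d x) xor odd y          ≡⟨ odd?-+ (agreement G x y + d x) (d y) ⟨
    odd? (agreement G x y + d x + d y)              ≡⟨ cong odd? (agreement+degᶜ G x y) ⟩
    odd? (10 + 2 * commonᶜ G x y)                   ≡⟨ odd?-+ 10 (2 * commonᶜ G x y) ⟩
    odd? (2 * commonᶜ G x y)                        ≡⟨ odd?-2* (commonᶜ G x y) ⟩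
    false                                           ∎)))
    where
    open ≡-Reasoning
    xor-solve : ∀ a b c → (a xor b) xor c ≡ false → a ≡ b xor c
    xor-solve false false false _ = refl
    xor-solve false true  true  _ = refl
    xor-solve true  false true  _ = refl
    xor-solve true  true  false _ = refl

  agreement⁺ : Fin 10 → Fin 10 → ℕ
  agreement⁺ x y = agreement G x y + ⟦ same x y ⟧

  -- An agreement between vertices whose co-degrees have equal parity is even, hence at most 4.
  agreement⁺≤5 : ∀ x y → y ≢ x → agreement⁺ x y ≤ 5
  agreement⁺≤5 x y y≢x = subst (λ b → agreement G x y + ⟦ b ⟧ ≤ 5) (sym (same-parity x y))
    (even≤4 (agreement G x y) (≤-pred (proj₂ bounded x y (y≢x ∘ sym))))
    where
    even≤4 : ∀ a → a ≤ 5 → a + ⟦ not (odd? a) ⟧ ≤ 5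
    even≤4 0 _ = from-yes (1 ≤? 5)
    even≤4 1 _ = from-yes (1 ≤? 5)
    even≤4 2 _ = from-yes (3 ≤? 5)
    even≤4 3 _ = from-yes (3 ≤? 5)
    even≤4 4 _ = from-yes (5 ≤? 5)
    even≤4 5 _ = from-yes (5 ≤? 5)
    even≤4 (suc (suc (suc (suc (suc (suc _)))))) (s≤s (s≤s (s≤s (s≤s (s≤s ())))))

  agreement⁺-diag : ∀ x → agreement⁺ x x ≡ 11
  agreement⁺-diag x = cong₂ _+_ (agreement-diag G x) (cong (λ b → ⟦ not b ⟧) (xor-same (odd x)))

  row≤56 : ∀ x → ∑[ y < 10 ] agreement⁺ x y ≤ 56
  row≤56 x = ≤-trans (sum-≤-except (agreement⁺ x) x (agreement⁺≤5 x))
                     (≤-reflexive (cong (_+ 45) (agreement⁺-diag x)))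

  #odd #even : ℕ
  #odd = count odd
  #even = count (not ∘ odd)

  slack : ℕ → ℕ
  slack δ = 2 * ((5 ∸ δ) * (5 ∸ δ))

  slackSum : ℕ
  slackSum = ∑[ x < 10 ] slack (d x)

  agreement⁺-total : ∑[ x < 10 ] ∑[ y < 10 ] agreement⁺ x y
                       ≡ 500 + slackSum + (#odd * #odd + #even * #even)
  agreement⁺-total = begin
    ∑[ x < 10 ] ∑[ y < 10 ] agreement⁺ x y
      ≡⟨ sum-cong-≗ (λ x → ∑-distrib-+ (agreement G x) (λ y → ⟦ same x y ⟧)) ⟩
    ∑[ x < 10 ] (∑[ y < 10 ] agreement G x y + count (same x))
      ≡⟨ ∑-distrib-+ (λ x → ∑[ y < 10 ] agreement G x y) (λ x → count (same x)) ⟩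
    (∑[ x < 10 ] ∑[ y < 10 ] agreement G x y) + (∑[ x < 10 ] count (same x))
      ≡⟨ cong₂ _+_ agreement-sum (agreeing-pairs odd) ⟩
    500 + slackSum + (#odd * #odd + #even * #even)
      ∎
    where
    open ≡-Reasoning
    completed-square : ∀ δ → δ ≤ 5 → 10 * δ + 10 * δ + 50 + slack δ ≡ 2 * (δ * δ) + 100
    completed-square 0 _ = refl
    completed-square 1 _ = refl
    completed-square 2 _ = refl
    completed-square 3 _ = refl
    completed-square 4 _ = refl
    completed-square 5 _ = refl
    completed-square (suc (suc (suc (suc (suc (suc _)))))) (s≤s (s≤s (s≤s (s≤s (s≤s ())))))
    D = ∑[ x < 10 ] d x
    Q = ∑[ x < 10 ] (d x * d x)
    squares : 10 * D + 10 * D + 500 + slackSum ≡ 2 * Q + 1000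
    squares = begin
      10 * D + 10 * D + 500 + slackSum
        ≡⟨ cong₂ (λ a b → a + b + 500 + slackSum) (*-distribˡ-sum 10 d) (*-distribˡ-sum 10 d) ⟩
      (∑[ x < 10 ] (10 * d x)) + (∑[ x < 10 ] (10 * d x)) + (∑[ x < 10 ] 50) + slackSum
        ≡⟨ cong (_+ slackSum) (sum-+₃ (λ x → 10 * d x) (λ x → 10 * d x) (λ _ → 50)) ⟨
      (∑[ x < 10 ] (10 * d x + 10 * d x + 50)) + slackSum
        ≡⟨ ∑-distrib-+ (λ x → 10 * d x + 10 * d x + 50) (λ x → slack (d x)) ⟨
      ∑[ x < 10 ] (10 * d x + 10 * d x + 50 + slack (d x))
        ≡⟨ sum-cong-≗ (λ x → completed-square (d x) (d≤5 x)) ⟩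
      ∑[ x < 10 ] (2 * (d x * d x) + 100)
        ≡⟨ ∑-distrib-+ (λ x → 2 * (d x * d x)) (λ _ → 100) ⟩
      (∑[ x < 10 ] (2 * (d x * d x))) + (∑[ x < 10 ] 100)
        ≡⟨ cong (_+ 1000) (*-distribˡ-sum 2 (λ x → d x * d x)) ⟨
      2 * Q + 1000
        ∎
    agreement-sum : ∑[ x < 10 ] ∑[ y < 10 ] agreement G x y ≡ 500 + slackSum
    agreement-sum = +-cancelʳ-≡ (10 * D + 10 * D) _ _ (begin
      (∑[ x < 10 ] ∑[ y < 10 ] agreement G x y) + (10 * D + 10 * D)
        ≡⟨ +-assoc (∑[ x < 10 ] ∑[ y < 10 ] agreement G x y) (10 * D) (10 * D) ⟨
      (∑[ x < 10 ] ∑[ y < 10 ] agreement G x y) + 10 * D + 10 * D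
        ≡⟨ agreement-total G ⟩
      1000 + 2 * Q
        ≡⟨ +-comm 1000 (2 * Q) ⟩
      2 * Q + 1000
        ≡⟨ squares ⟨
      10 * D + 10 * D + 500 + slackSum
        ≡⟨ rearrange (10 * D + 10 * D) slackSum ⟩
      500 + slackSum + (10 * D + 10 * D)
        ∎)
      where
      rearrange : ∀ a w → a + 500 + w ≡ 500 + w + a
      rearrange = solve-∀

  #odd-even : odd? #odd ≡ false
  #odd-even = trans (odd?-count d)
    (handshake (λ x y → ⟦ adjᶜ G x y ⟧) (λ x y → cong ⟦_⟧ (adjᶜ-sym G x y))
               (λ x → cong ⟦_⟧ (adjᶜ-irrefl G x)))

  slack≥ : ∀ δ → δ ≤ 5 → 2 * ⟦ not (odd? δ) ⟧ ≤ slack δ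
  slack≥ 0 _ = from-yes (2 ≤? 50)
  slack≥ 1 _ = z≤n
  slack≥ 2 _ = from-yes (2 ≤? 18)
  slack≥ 3 _ = z≤n
  slack≥ 4 _ = from-yes (2 ≤? 2)
  slack≥ 5 _ = z≤n
  slack≥ (suc (suc (suc (suc (suc (suc _)))))) (s≤s (s≤s (s≤s (s≤s (s≤s ())))))

  slack-tight : ∀ δ → δ ≤ 5 → 2 * ⟦ not (odd? δ) ⟧ ≡ slack δ → δ ≡ 4 + ⟦ odd? δ ⟧
  slack-tight 4 _ _ = refl
  slack-tight 5 _ _ = refl
  slack-tight 0 _ ()
  slack-tight 1 _ ()
  slack-tight 2 _ ()
  slack-tight 3 _ ()
  slack-tight (suc (suc (suc (suc (suc (suc _)))))) (s≤s (s≤s (s≤s (s≤s (s≤s ()))))) _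

  class-sizes : ∀ o e → o + e ≡ 10 → odd? o ≡ false → 2 * e + (o * o + e * e) ≤ 60 → o ≡ 6 × e ≡ 4
  class-sizes 6 _ refl _ _ = refl , refl
  class-sizes 0 _ refl _ le = contradiction le (from-no (120 ≤? 60))
  class-sizes 2 _ refl _ le = contradiction le (from-no (84 ≤? 60))
  class-sizes 4 _ refl _ le = contradiction le (from-no (64 ≤? 60))
  class-sizes 8 _ refl _ le = contradiction le (from-no (72 ≤? 60))
  class-sizes 10 _ refl _ le = contradiction le (from-no (100 ≤? 60))
  class-sizes 1 _ _ () _
  class-sizes 3 _ _ () _
  class-sizes 5 _ _ () _
  class-sizes 7 _ _ () _
  class-sizes 9 _ _ () _
  class-sizes (suc (suc (suc (suc (suc (suc (suc (suc (suc (suc (suc _))))))))))) _ () _ _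

  slackSum+squares≤60 : slackSum + (#odd * #odd + #even * #even) ≤ 60
  slackSum+squares≤60 = +-cancelˡ-≤ 500 _ _ (begin
    500 + (slackSum + (#odd * #odd + #even * #even))   ≡⟨ +-assoc 500 slackSum _ ⟨
    500 + slackSum + (#odd * #odd + #even * #even)     ≡⟨ agreement⁺-total ⟨
    ∑[ x < 10 ] ∑[ y < 10 ] agreement⁺ x y             ≤⟨ sum-mono-≤ row≤56 ⟩
    ∑[ x < 10 ] 56                                     ≡⟨ sum-const 10 56 ⟩
    560                                                ∎)
    where open ≤-Reasoning

  slackSum≥2#even : 2 * #even ≤ slackSum
  slackSum≥2#even = ≤-trans (≤-reflexive (*-distribˡ-sum 2 (λ x → ⟦ not (odd x) ⟧)))
                            (sum-mono-≤ (λ x → slack≥ (d x) (d≤5 x)))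

  #odd≡6×#even≡4 : #odd ≡ 6 × #even ≡ 4
  #odd≡6×#even≡4 = class-sizes #odd #even (count+count-not odd) #odd-even
                               (≤-trans (+-monoˡ-≤ _ slackSum≥2#even) slackSum+squares≤60)

  #odd≡6 : #odd ≡ 6
  #odd≡6 = proj₁ #odd≡6×#even≡4

  #even≡4 : #even ≡ 4
  #even≡4 = proj₂ #odd≡6×#even≡4

  slackSum≡8 : slackSum ≡ 8
  slackSum≡8 = ≤-antisym (≤8 slackSum #odd #even #odd≡6 #even≡4 slackSum+squares≤60)
                         (subst (λ b → 2 * b ≤ slackSum) #even≡4 slackSum≥2#even)
    where
    ≤8 : ∀ w a b → a ≡ 6 → b ≡ 4 → w + (a * a + b * b) ≤ 60 → w ≤ 8
    ≤8 w _ _ refl refl le = +-cancelʳ-≤ 52 w 8 le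

  d≡4+odd : ∀ x → d x ≡ 4 + ⟦ odd x ⟧
  d≡4+odd x = slack-tight (d x) (d≤5 x) (sum-mono-≤-tight (λ x → slack≥ (d x) (d≤5 x)) (begin
    slackSum                            ≡⟨ slackSum≡8 ⟩
    2 * 4                               ≡⟨ cong (2 *_) #even≡4 ⟨
    2 * #even                           ≡⟨ *-distribˡ-sum 2 (λ x → ⟦ not (odd x) ⟧) ⟩
    ∑[ x < 10 ] (2 * ⟦ not (odd x) ⟧)   ∎) x)
    where open ≤-Reasoning

  agreement⁺≡5 : ∀ x y → y ≢ x → agreement⁺ x y ≡ 5
  agreement⁺≡5 x = sum-≤-except-tight (agreement⁺ x) x (agreement⁺≤5 x)
    (≤-reflexive (trans (cong (_+ 45) (agreement⁺-diag x)) (sym (row≡56 x))))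
    where
    total≡560 : ∑[ x < 10 ] ∑[ y < 10 ] agreement⁺ x y ≡ 560
    total≡560 = trans agreement⁺-total (560-from slackSum #odd #even slackSum≡8 #odd≡6 #even≡4)
      where
      560-from : ∀ w a b → w ≡ 8 → a ≡ 6 → b ≡ 4 → 500 + w + (a * a + b * b) ≡ 560
      560-from _ _ _ refl refl refl = refl
    row≡56 : ∀ x → ∑[ y < 10 ] agreement⁺ x y ≡ 56
    row≡56 = sum-mono-≤-tight row≤56 (≤-reflexive (trans (sum-const 10 56) (sym total≡560)))

  commonᶜ≡ : ∀ x y → y ≢ x → commonᶜ G x y ≡ 1 + ⟦ odd x ∨ odd y ⟧
  commonᶜ≡ x y y≢x = from-counts (odd x) (odd y) (agreement⁺≡5 x y y≢x)
    (trans (cong₂ (λ a b → agreement G x y + a + b) (sym (d≡4+odd x)) (sym (d≡4+odd y)))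
           (agreement+degᶜ G x y))
    where
    half : ∀ m k → 10 + 2 * m ≡ 10 + 2 * k → m ≡ k
    half m k eq = *-cancelˡ-≡ m k 2 (+-cancelˡ-≡ 10 _ _ eq)
    from-counts : ∀ p q {a m} → a + ⟦ not (p xor q) ⟧ ≡ 5 → a + (4 + ⟦ p ⟧) + (4 + ⟦ q ⟧) ≡ 10 + 2 * m →
                  m ≡ 1 + ⟦ p ∨ q ⟧
    from-counts true  true  {a} {m} e1 e2 with +-cancelʳ-≡ 1 a 4 e1
    ... | refl = half m 2 (sym e2)
    from-counts true  false {a} {m} e1 e2 with +-cancelʳ-≡ 0 a 5 e1
    ... | refl = half m 2 (sym e2)
    from-counts false true  {a} {m} e1 e2 with +-cancelʳ-≡ 0 a 5 e1
    ... | refl = half m 2 (sym e2)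
    from-counts false false {a} {m} e1 e2 with +-cancelʳ-≡ 1 a 4 e1
    ... | refl = half m 1 (sym e2)

  d≡4 : ∀ b → odd b ≡ false → d b ≡ 4
  d≡4 b b-even = trans (d≡4+odd b) (cong (λ t → 4 + ⟦ t ⟧) b-even)

  d≡5 : ∀ a → odd a ≡ true → d a ≡ 5
  d≡5 a a-odd = trans (d≡4+odd a) (cong (λ t → 4 + ⟦ t ⟧) a-odd)

  adjᶜ-odd adjᶜ-even : Fin 10 → Fin 10 → Bool
  adjᶜ-odd b w = adjᶜ G b w ∧ odd w
  adjᶜ-even b w = adjᶜ G b w ∧ not (odd w)

  -- Σ_y commonᶜ G b y, evaluated once from the values of commonᶜ and once by double counting.
  commonᶜ-row-even : ∀ b → odd b ≡ false → 19 ≡ 4 * 4 + count (adjᶜ-odd b)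
  commonᶜ-row-even b b-even = begin
    19
      ≡⟨ cong (λ k → 4 + (9 + k)) odd-rest ⟨
    4 + (9 + count (odd ∘ punchIn b))
      ≡⟨ cong₂ _+_ (sym (trans (commonᶜ-diag G b) (d≡4 b b-even)))
                   (sym (trans (∑-distrib-+ (λ _ → 1) (λ j → ⟦ odd (punchIn b j) ⟧))
                               (cong (_+ count (odd ∘ punchIn b)) (sum-const 9 1)))) ⟩
    commonᶜ G b b + ∑[ j < 9 ] (1 + ⟦ odd (punchIn b j) ⟧)
      ≡⟨ cong (commonᶜ G b b +_) (sum-cong-≗ λ j → sym (off-diagonal j)) ⟩
    commonᶜ G b b + ∑[ j < 9 ] commonᶜ G b (punchIn b j)
      ≡⟨ sum-remove {i = b} (commonᶜ G b) ⟨
    ∑[ y < 10 ] commonᶜ G b y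
      ≡⟨ commonᶜ-row G b ⟩
    ∑[ w < 10 ] (⟦ adjᶜ G b w ⟧ * d w)
      ≡⟨ sum-cong-≗ (λ w → trans (cong (⟦ adjᶜ G b w ⟧ *_) (d≡4+odd w)) (split (adjᶜ G b w) (odd w))) ⟩
    ∑[ w < 10 ] (4 * ⟦ adjᶜ G b w ⟧ + ⟦ adjᶜ-odd b w ⟧)
      ≡⟨ trans (∑-distrib-+ (λ w → 4 * ⟦ adjᶜ G b w ⟧) (λ w → ⟦ adjᶜ-odd b w ⟧))
               (cong (_+ count (adjᶜ-odd b)) (sym (*-distribˡ-sum 4 (λ w → ⟦ adjᶜ G b w ⟧)))) ⟩
    4 * d b + count (adjᶜ-odd b)
      ≡⟨ cong (λ k → 4 * k + count (adjᶜ-odd b)) (d≡4 b b-even) ⟩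
    4 * 4 + count (adjᶜ-odd b)
      ∎
    where
    open ≡-Reasoning
    odd-rest : count (odd ∘ punchIn b) ≡ 6
    odd-rest = begin
      count (odd ∘ punchIn b)                 ≡⟨ cong (λ t → ⟦ t ⟧ + count (odd ∘ punchIn b)) b-even ⟨
      ⟦ odd b ⟧ + count (odd ∘ punchIn b)     ≡⟨ sum-remove {i = b} (λ x → ⟦ odd x ⟧) ⟨
      #odd                                    ≡⟨ #odd≡6 ⟩
      6                                       ∎
    off-diagonal : ∀ j → commonᶜ G b (punchIn b j) ≡ 1 + ⟦ odd (punchIn b j) ⟧
    off-diagonal j = trans (commonᶜ≡ b (punchIn b j) (punchInᵢ≢i b j))
                           (cong (λ t → 1 + ⟦ t ∨ odd (punchIn b j) ⟧) b-even)
    split : ∀ a p → ⟦ a ⟧ * (4 + ⟦ p ⟧) ≡ 4 * ⟦ a ⟧ + ⟦ a ∧ p ⟧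
    split false p = refl
    split true false = refl
    split true true = refl

  even-nbrs≡1 : ∀ b → odd b ≡ false → count (adjᶜ-even b) ≡ 1
  even-nbrs≡1 b b-even = +-cancelˡ-≡ 3 _ _ (begin
    3 + count (adjᶜ-even b)
      ≡⟨ cong (_+ count (adjᶜ-even b)) (+-cancelˡ-≡ 16 _ _ (commonᶜ-row-even b b-even)) ⟩
    count (adjᶜ-odd b) + count (adjᶜ-even b)
      ≡⟨ count-split (adjᶜ G b) odd ⟨
    d b
      ≡⟨ d≡4 b b-even ⟩
    4
      ∎)
    where open ≡-Reasoning

  even-partner-unique : ∀ {b u v} → odd b ≡ false → adjᶜ-even b u ≡ true → adjᶜ-even b v ≡ true → u ≡ v
  even-partner-unique {b} b-even = count-unique (adjᶜ-even b) (even-nbrs≡1 b b-even)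

  only-partner : ∀ {b b′ c} → odd b ≡ false → adjᶜ-even b b′ ≡ true → odd c ≡ false → c ≢ b′ →
                 adjᶜ G b c ≡ false
  only-partner {b} {b′} {c} b-even b~b′ c-even c≢b′ = by-cases (adjᶜ G b c) refl
    where
    by-cases : ∀ t → adjᶜ G b c ≡ t → adjᶜ G b c ≡ false
    by-cases false b≁c = b≁c
    by-cases true b~c = ⊥-elim (c≢b′ (even-partner-unique b-even (cong₂ _∧_ b~c (cong not c-even)) b~b′))

  no-odd-common : ∀ {a b c} → odd a ≡ true → b ≢ c → adjᶜ G b c ≡ false →
                  (∀ {w} → adjᶜ G b w ≡ true → adjᶜ G c w ≡ true → w ≡ a) →
                  adjᶜ G b a ≡ true → adjᶜ G c a ≡ true → ⊥
  no-odd-common {a} {b} {c} a-odd b≢c b≁c common⊆a b~a c~a =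
    6≰5 (commonᶜ G a b) (commonᶜ G a c) (d a)
        (trans (commonᶜ≡ a b (adjᶜ⇒≢ G a~b)) (cong (λ t → 1 + ⟦ t ∨ odd b ⟧) a-odd))
        (trans (commonᶜ≡ a c (adjᶜ⇒≢ G a~c)) (cong (λ t → 1 + ⟦ t ∨ odd c ⟧) a-odd))
        (d≡5 a a-odd)
        (commonᶜ-packing G a~b a~c b≢c b≁c common⊆a)
    where
    a~b = trans (adjᶜ-sym G a b) b~a
    a~c = trans (adjᶜ-sym G a c) c~a
    6≰5 : ∀ p q r → p ≡ 2 → q ≡ 2 → r ≡ 5 → ¬ 2 + p + q ≤ r
    6≰5 _ _ _ refl refl refl = from-no (6 ≤? 5)

  no-even-common : ∀ {a b b′ c} → odd b ≡ false → adjᶜ-even b b′ ≡ true → odd c ≡ false → c ≢ b →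
                   odd a ≡ false → adjᶜ G b a ≡ true → adjᶜ G c a ≡ true → ⊥
  no-even-common {a} {b} {b′} {c} b-even b~b′ c-even c≢b a-even b~a c~a =
    c≢b (even-partner-unique b′-even (even-nbr c~b′ c-even) (even-nbr b′~b b-even))
    where
    even-nbr : ∀ {x y} → adjᶜ G x y ≡ true → odd y ≡ false → adjᶜ-even x y ≡ true
    even-nbr x~y y-even = cong₂ _∧_ x~y (cong not y-even)
    a≡b′ : a ≡ b′
    a≡b′ = even-partner-unique b-even (even-nbr b~a a-even) b~b′
    b′-even : odd b′ ≡ false
    b′-even = subst (λ x → odd x ≡ false) a≡b′ a-even
    b′~b : adjᶜ G b′ b ≡ true
    b′~b = trans (adjᶜ-sym G b′ b) (proj₁ (∧-≡-true⁻ b~b′))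
    c~b′ : adjᶜ G b′ c ≡ true
    c~b′ = subst (λ x → adjᶜ G x c ≡ true) a≡b′ (trans (adjᶜ-sym G a c) c~a)

  no-third-even : ∀ {b b′ c} → odd b ≡ false → adjᶜ-even b b′ ≡ true → odd c ≡ false → c ≢ b → c ≢ b′ → ⊥
  no-third-even {b} {b′} {c} b-even b~b′ c-even c≢b c≢b′ =
    via (0<count⇒∃ common (≤-reflexive (sym common≡1)))
    where
    common : Fin 10 → Bool
    common w = adjᶜ G b w ∧ adjᶜ G c w
    common≡1 : count common ≡ 1
    common≡1 = trans (commonᶜ≡ b c c≢b) (cong₂ (λ s t → 1 + ⟦ s ∨ t ⟧) b-even c-even)
    by-parity : ∀ {a} → common a ≡ true → ∀ t → odd a ≡ t → ⊥
    by-parity b~a∧c~a true a-odd = no-odd-common a-odd (c≢b ∘ sym) (only-partner b-even b~b′ c-even c≢b′)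
      (λ b~w c~w → count-unique common common≡1 (cong₂ _∧_ b~w c~w) b~a∧c~a)
      (proj₁ (∧-≡-true⁻ b~a∧c~a)) (proj₂ (∧-≡-true⁻ b~a∧c~a))
    by-parity b~a∧c~a false a-even =
      no-even-common b-even b~b′ c-even c≢b a-even (proj₁ (∧-≡-true⁻ b~a∧c~a)) (proj₂ (∧-≡-true⁻ b~a∧c~a))
    via : (∃ λ a → common a ≡ true) → ⊥
    via (a , b~a∧c~a) = by-parity b~a∧c~a (odd a) refl

  absurd : ⊥
  absurd = from-even (0<count⇒∃ (not ∘ odd) (subst (0 <_) (sym #even≡4) z<s))
    where
    from-partner : ∀ {b} → odd b ≡ false → (∃ λ b′ → adjᶜ-even b b′ ≡ true) → ⊥
    from-partner {b} b-even (b′ , b~b′) =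
      from-third (∃-outside-pair (not ∘ odd) b b′ (subst (2 <_) (sym #even≡4) (from-yes (2 <? 4))))
      where
      from-third : (∃ λ c → not (odd c) ≡ true × c ≢ b × c ≢ b′) → ⊥
      from-third (c , c-even , c≢b , c≢b′) = no-third-even b-even b~b′ (not≡true c-even) c≢b c≢b′
    from-even : (∃ λ b → not (odd b) ≡ true) → ⊥
    from-even (b , b-even) =
      from-partner (not≡true b-even)
                   (0<count⇒∃ (adjᶜ-even b) (≤-reflexive (sym (even-nbrs≡1 b (not≡true b-even)))))

no-Bounded-10 : ¬ Σ (Graph 10) (λ G → Bounded G 6)
no-Bounded-10 (G , bounded) = TenVertices.absurd G bounded

bounded? : ∀ {n} (G : Graph n) k → Dec (Bounded G k)
bounded? G k = all? (λ x → degᶜ G x <? k)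
         ×-dec all? (λ x → all? (λ y → ¬? (x ≟ y) →-dec (agreement G x y <? k)))

edgesAdjacency : ∀ {n} → List (ℕ × ℕ) → Fin n → Fin n → Bool
edgesAdjacency edges x y =
  any (λ (i , j) → ((toℕ x ≡ᵇ i) ∧ (toℕ y ≡ᵇ j)) ∨ ((toℕ x ≡ᵇ j) ∧ (toℕ y ≡ᵇ i))) edges

fromEdges : ∀ n (edges : List (ℕ × ℕ)) →
            {True (all? λ x → all? λ y → edgesAdjacency {n} edges x y ≟ᵇ edgesAdjacency edges y x)} →
            {True (all? λ x → edgesAdjacency {n} edges x x ≟ᵇ false)} → Graph n
fromEdges n edges {symmetric} {irreflexive} = record
  { adj    = edgesAdjacency edges
  ; sym    = toWitness symmetric
  ; irrefl = toWitness irreflexive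
  }

-- The 3-cube: 1, 2, 3 are the neighbours of 0 and 4, 5, 6 those of its antipode 7.
cube : Graph 8
cube = fromEdges 8
  ((0 , 1) ∷ (0 , 2) ∷ (0 , 3) ∷ (1 , 4) ∷ (1 , 5) ∷ (2 , 4) ∷
   (2 , 6) ∷ (3 , 5) ∷ (3 , 6) ∷ (4 , 7) ∷ (5 , 7) ∷ (6 , 7) ∷ [])

-- The 3-cube on 1, …, 8 together with a vertex 0 adjacent to all of them.
cube-cone : Graph 9
cube-cone = fromEdges 9
  ((0 , 1) ∷ (0 , 2) ∷ (0 , 3) ∷ (0 , 4) ∷ (0 , 5) ∷ (0 , 6) ∷ (0 , 7) ∷ (0 , 8) ∷
   (1 , 2) ∷ (1 , 3) ∷ (1 , 4) ∷ (2 , 5) ∷ (2 , 6) ∷ (3 , 5) ∷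
   (3 , 7) ∷ (4 , 6) ∷ (4 , 7) ∷ (5 , 8) ∷ (6 , 8) ∷ (7 , 8) ∷ [])

quintic-12 : Graph 12
quintic-12 = fromEdges 12
  ((0 , 1) ∷ (0 , 3) ∷ (0 , 7) ∷ (0 , 10) ∷ (0 , 11) ∷ (1 , 2) ∷ (1 , 4) ∷ (1 , 6) ∷ (1 , 10) ∷ (2 , 3) ∷
   (2 , 5) ∷ (2 , 9) ∷ (2 , 11) ∷ (3 , 6) ∷ (3 , 7) ∷ (3 , 9) ∷ (4 , 5) ∷ (4 , 6) ∷ (4 , 7) ∷ (4 , 9) ∷
   (5 , 7) ∷ (5 , 10) ∷ (5 , 11) ∷ (6 , 8) ∷ (6 , 11) ∷ (7 , 8) ∷ (8 , 9) ∷ (8 , 10) ∷ (8 , 11) ∷ (9 , 10) ∷ [])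

theorem18 : IsXi 5 8 × IsXi 6 9 × ∃ (λ m → IsXi 7 m × 11 ≤ m × m ≤ 12)
theorem18 =
  IsXi-intro 5 8 (from-yes (5 ≤? 8)) (cube , from-yes (bounded? cube 5)) (no-Bounded-odd 1) ,
  IsXi-intro 6 9 (from-yes (6 ≤? 9)) (cube-cone , from-yes (bounded? cube-cone 6)) no-Bounded-10 ,
  12 , IsXi-intro 7 12 (from-yes (7 ≤? 12)) (quintic-12 , from-yes (bounded? quintic-12 7)) (no-Bounded-odd 2) ,
       from-yes (11 ≤? 12) , from-yes (12 ≤? 12)
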